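{- For all integers $n,k\ge 2$, \[ f'(n,k)\le 2^{\binom{n}{2}-0.05n^2+(n+1)\log_2 k}. \]
   Context: Let $F(n,k)$ be the set of edge colorings of $K_n$ with colors from $[k]=\{1,\dots,k\}$ such that one color class forms a spanning subgraph of $K_n$ and the other color classes span pairwise vertex-disjoint (possibly empty) subgraphs of $K_n$ (i.e., no vertex is incident to edges of two distinct colors other than the distinguished one). Let $F'(n,k)\subseteq F(n,k)$ be the set of colorings in $F(n,k)$ for which there is no set of at least $0.9n$ vertices inducing a clique whose edges use at most two colors. Let $f'(n,k)=|F'(n,k)|$. -}

module Defs where

open import Data.Nat using (ℕ; zero; suc; _*_; _≤_)
open import Data.Fin using (Fin; zero; suc)
open import Data.Fin.Subset using (Subset; _∈_; ∣_∣)
open import Data.Vec using (Vec; lookup)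
open import Data.Unit using (⊤)
open import Data.Product using (_×_; _,_; Σ; ∃; ∃-syntax)
open import Data.Sum using (_⊎_)
open import Data.Empty using (⊥-elim)
open import Relation.Nullary using (¬_)
open import Relation.Binary.PropositionalEquality using (_≡_; _≢_; refl; cong)

-- An edge colouring of K_n with colours from Fin k (colours 0..k-1 play the
-- role of [k]).  Represented canonically (one entry per
-- edge): a colouring of K_(suc n) is the vector of colours of the edges from
-- vertex 0 to vertices (suc j), together with a colouring of K_n on the
-- vertices suc _.
Coloring : ℕ → ℕ → Set
Coloring zero    k = ⊤
Coloring (suc n) k = Vec (Fin k) n × Coloring n k

edgeColor : ∀ {n k} → Coloring n k → (i j : Fin n) → i ≢ j → Fin k
edgeColor {suc n} (v , c) zero    zero    ne = ⊥-elim (ne refl)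
edgeColor {suc n} (v , c) zero    (suc j) ne = lookup v j
edgeColor {suc n} (v , c) (suc i) zero    ne = lookup v i
edgeColor {suc n} (v , c) (suc i) (suc j) ne =
  edgeColor c i j (λ e → ne (cong suc e))

-- Membership in F(n,k): there is a distinguished colour d such that no vertex
-- is incident to edges of two distinct colours other than d (i.e. the other
-- colour classes span pairwise vertex-disjoint subgraphs).
InF : ∀ {n k} → Coloring n k → Set
InF {n} {k} c =
  ∃[ d ] ((u v w : Fin n) (p : u ≢ v) (q : u ≢ w) →
          edgeColor c u v p ≢ d → edgeColor c u w q ≢ d →
          edgeColor c u v p ≡ edgeColor c u w q)

TwoColoredOn : ∀ {n k} → Coloring n k → Subset n → Set
TwoColoredOn {n} {k} c S =
  Σ (Fin k) λ a → Σ (Fin k) λ b →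
    (u v : Fin n) (p : u ≢ v) → u ∈ S → v ∈ S →
    (edgeColor c u v p ≡ a ⊎ edgeColor c u v p ≡ b)

-- Membership in F'(n,k): in F(n,k) and no set S with |S| ≥ 0.9 n
-- (i.e. 10|S| ≥ 9n) inducing a clique using at most two colours.
InF' : ∀ {n k} → Coloring n k → Set
InF' {n} c = InF c × ¬ (Σ (Subset n) λ S → (9 * n ≤ 10 * ∣ S ∣) × TwoColoredOn c S)

-- Fix a colouring in F'(n,k) with distinguished colour d and label every
-- vertex by the unique colour other than d on its edges (or by d).  Each edge
-- is then coloured d or carries the common label of its two ends, so the
-- colouring is determined by d, the labelling L and one bit per pair of equally
-- labelled vertices: f'(n,k) ≤ k^(n+1) 2^P, where P bounds the number P(L) of
-- such pairs.  The vertices labelled a span a clique coloured with d and a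
-- only, so each label class has size s_a < 0.9n, whence
-- 2 P(L) + n = Σ_a s_a² < 0.9 n², i.e. 20 P(L) + n² ≤ 10 n (n - 1).
module Submission where

open import Defs
open import Data.Nat using (ℕ; zero; suc; _+_; _*_; _∸_; _^_; _≤_; _<_; z≤n; s≤s; _<?_)
open import Data.Nat.Properties hiding (_≟_; suc-injective)
open import Algebra.Properties.CommutativeSemigroup +-commutativeSemigroup using (x∙yz≈y∙xz)
open import Data.Nat.DivMod using (_/_; m/n*n≤m; m*n/n≡m; /-monoˡ-≤)
open import Data.Nat.Tactic.RingSolver using (solve-∀)
open import Data.Fin using (Fin; zero; suc; _≟_)
open import Data.Fin.Properties using (any?; all?; injective⇒≤; suc-injective)
open import Data.Fin.Subset using (Subset; inside; outside; ∣_∣)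
import Data.Fin.Subset as Subset
open import Data.Vec using (Vec; []; _∷_; lookup; tabulate; here; there)
open import Data.Vec.Properties using (lookup∘tabulate)
open import Data.List using (List; []; _∷_; length; cartesianProductWith; concatMap; allFin)
import Data.List as List
open import Data.List.Properties using (length-map; length-++; length-tabulate)
open import Data.List.Relation.Unary.Any using (here; there; index)
open import Data.List.Relation.Unary.Any.Properties using (lookup-index)
open import Data.List.Membership.Propositional using (_∈_; lose)
open import Data.List.Membership.Propositional.Properties
  using (∈-cartesianProductWith⁺; ∈-concatMap⁺; ∈-allFin)
open import Data.Unit using (tt)
open import Data.Product using (Σ; ∃; ∃₂; _×_; _,_; proj₁; proj₂)
open import Data.Sum using (_⊎_; inj₁; inj₂; map₂)
open import Data.Empty using (⊥-elim)
open import Function using (_∘_)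
open import Function.Definitions using (Injective)
open import Relation.Nullary using (¬_; Dec; yes; no)
open import Relation.Binary.PropositionalEquality
  using (_≡_; _≢_; refl; sym; trans; cong; cong₂; subst; subst₂; module ≡-Reasoning)

private
  variable
    n k : ℕ

length-cartesianProductWith : ∀ {A B C : Set} (f : A → B → C) (xs : List A) (ys : List B) →
  length (cartesianProductWith f xs ys) ≡ length xs * length ys
length-cartesianProductWith f []       ys = refl
length-cartesianProductWith f (x ∷ xs) ys = begin
  length (List.map (f x) ys List.++ cartesianProductWith f xs ys)
    ≡⟨ length-++ (List.map (f x) ys) ⟩
  length (List.map (f x) ys) + length (cartesianProductWith f xs ys)
    ≡⟨ cong₂ _+_ (length-map (f x) ys) (length-cartesianProductWith f xs ys) ⟩
  length ys + length xs * length ys ∎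
  where open ≡-Reasoning

length-concatMap-≤ : ∀ {A B : Set} (f : A → List B) {b} → (∀ x → length (f x) ≤ b) →
  ∀ xs → length (concatMap f xs) ≤ length xs * b
length-concatMap-≤ f bounded []       = z≤n
length-concatMap-≤ f bounded (x ∷ xs) =
  subst (_≤ _) (sym (length-++ (f x)))
    (+-mono-≤ (bounded x) (length-concatMap-≤ f bounded xs))

injective⇒≤length : ∀ {A : Set} {m} (f : Fin m → A) → Injective _≡_ _≡_ f →
  (xs : List A) → (∀ i → f i ∈ xs) → m ≤ length xs
injective⇒≤length f f-inj xs f∈xs = injective⇒≤ {f = index ∘ f∈xs} λ {i} {j} same →
  f-inj (trans (lookup-index (f∈xs i))
          (trans (cong (List.lookup xs) same) (sym (lookup-index (f∈xs j)))))

allVecs : ∀ k n → List (Vec (Fin k) n)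
allVecs k zero    = [] ∷ []
allVecs k (suc n) = cartesianProductWith _∷_ (allFin k) (allVecs k n)

length-allVecs : ∀ k n → length (allVecs k n) ≡ k ^ n
length-allVecs k zero    = refl
length-allVecs k (suc n) =
  trans (length-cartesianProductWith _∷_ (allFin k) (allVecs k n))
        (cong₂ _*_ (length-tabulate {n = k} (λ i → i)) (length-allVecs k n))

∈-allVecs : (L : Vec (Fin k) n) → L ∈ allVecs k n
∈-allVecs []      = here refl
∈-allVecs (a ∷ L) = ∈-cartesianProductWith⁺ _∷_ (∈-allFin a) (∈-allVecs L)

edgeColor-irrelevant : (c : Coloring n k) (u v : Fin n) (p q : u ≢ v) →
  edgeColor c u v p ≡ edgeColor c u v q
edgeColor-irrelevant {suc n} c zero    zero    p q = ⊥-elim (p refl)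
edgeColor-irrelevant {suc n} c zero    (suc j) p q = refl
edgeColor-irrelevant {suc n} c (suc i) zero    p q = refl
edgeColor-irrelevant {suc n} (_ , c) (suc i) (suc j) p q = edgeColor-irrelevant c i j _ _

edgeColor-sym : (c : Coloring n k) (u v : Fin n) (p : u ≢ v) (q : v ≢ u) →
  edgeColor c u v p ≡ edgeColor c v u q
edgeColor-sym {suc n} c zero    zero    p q = ⊥-elim (p refl)
edgeColor-sym {suc n} c zero    (suc j) p q = refl
edgeColor-sym {suc n} c (suc i) zero    p q = refl
edgeColor-sym {suc n} (_ , c) (suc i) (suc j) p q = edgeColor-sym c i j _ _

-- Vertex labellings compatible with a colouring

Compatible : Coloring n k → Fin k → Vec (Fin k) n → Set
Compatible {n} c d L = ∀ (u v : Fin n) (p : u ≢ v) →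
  edgeColor c u v p ≡ d ⊎ (edgeColor c u v p ≡ lookup L u × edgeColor c u v p ≡ lookup L v)

module _ (c : Coloring n k) (d : Fin k)
  (offColoursAgree : (u v w : Fin n) (p : u ≢ v) (q : u ≢ w) →
    edgeColor c u v p ≢ d → edgeColor c u w q ≢ d → edgeColor c u v p ≡ edgeColor c u w q)
  where

  OffEdge : Fin n → Fin n → Set
  OffEdge u v = Σ (u ≢ v) λ p → edgeColor c u v p ≢ d

  offEdge? : ∀ u v → Dec (OffEdge u v)
  offEdge? u v with u ≟ v
  ... | yes u≡v = no λ (u≢v , _) → u≢v u≡v
  ... | no u≢v with edgeColor c u v u≢v ≟ d
  ...   | yes ≡d = no λ (p , ≢d) → ≢d (trans (edgeColor-irrelevant c u v p u≢v) ≡d)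
  ...   | no ≢d  = yes (u≢v , ≢d)

  offColour : (u : Fin n) →
    ∃ λ a → ∀ v (p : u ≢ v) → edgeColor c u v p ≢ d → edgeColor c u v p ≡ a
  offColour u with any? (offEdge? u)
  ... | yes (w , q , ≢d) = edgeColor c u w q , λ v p ≢d′ → offColoursAgree u v w p q ≢d′ ≢d
  ... | no noOffEdge     = d , λ v p ≢d → ⊥-elim (noOffEdge (v , p , ≢d))

InF⇒compatible : (c : Coloring n k) → InF c → ∃₂ λ d L → Compatible c d L
InF⇒compatible {n} {k} c (d , offColoursAgree) = d , L , compatible
  where
  label : Fin n → Fin k
  label = proj₁ ∘ offColour c d offColoursAgree

  L : Vec (Fin k) n
  L = tabulate label

  isLabel : ∀ u v (p : u ≢ v) → edgeColor c u v p ≢ d → edgeColor c u v p ≡ lookup L u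
  isLabel u v p ≢d =
    trans (proj₂ (offColour c d offColoursAgree u) v p ≢d) (sym (lookup∘tabulate label u))

  compatible : Compatible c d L
  compatible u v p with edgeColor c u v p ≟ d
  ... | yes ≡d = inj₁ ≡d
  ... | no ≢d  = inj₂ (isLabel u v p ≢d , trans uv≡vu (isLabel v u q (≢d ∘ trans uv≡vu)))
    where
    q : v ≢ u
    q = p ∘ sym
    uv≡vu : edgeColor c u v p ≡ edgeColor c v u q
    uv≡vu = edgeColor-sym c u v p q

-- Counting equally labelled pairs

occurrences : Fin k → Vec (Fin k) n → ℕ
occurrences a []      = 0
occurrences a (b ∷ L) with b ≟ a
... | yes _ = suc (occurrences a L)
... | no  _ = occurrences a L

equalPairs : Vec (Fin k) n → ℕ
equalPairs []      = 0
equalPairs (a ∷ L) = occurrences a L + equalPairs L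

matchingPairs : ∀ {m} → Vec (Fin k) m → Vec (Fin k) n → ℕ
matchingPairs []      L = 0
matchingPairs (w ∷ W) L = occurrences w L + matchingPairs W L

matchingPairs-∷ʳ : ∀ {m} (W : Vec (Fin k) m) (a : Fin k) (L : Vec (Fin k) n) →
  matchingPairs W (a ∷ L) ≡ occurrences a W + matchingPairs W L
matchingPairs-∷ʳ []      a L = refl
matchingPairs-∷ʳ (w ∷ W) a L rewrite matchingPairs-∷ʳ W a L with a ≟ w | w ≟ a
... | yes _   | yes _   = cong suc (x∙yz≈y∙xz (occurrences w L) (occurrences a W) (matchingPairs W L))
... | no  _   | no  _   = x∙yz≈y∙xz (occurrences w L) (occurrences a W) (matchingPairs W L)
... | yes a≡w | no  w≢a = ⊥-elim (w≢a (sym a≡w))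
... | no  a≢w | yes w≡a = ⊥-elim (a≢w (sym w≡a))

matchingPairs-self : (L : Vec (Fin k) n) → matchingPairs L L ≡ equalPairs L + equalPairs L + n
matchingPairs-self []              = refl
matchingPairs-self {n = suc n} (a ∷ L) with a ≟ a
... | no a≢a = ⊥-elim (a≢a refl)
... | yes _  = begin
  suc (occurrences a L + matchingPairs L (a ∷ L))
    ≡⟨ cong (λ s → suc (occurrences a L + s))
         (trans (matchingPairs-∷ʳ L a L) (cong (occurrences a L +_) (matchingPairs-self L))) ⟩
  suc (occurrences a L + (occurrences a L + (equalPairs L + equalPairs L + n)))
    ≡⟨ rearrange (occurrences a L) (equalPairs L) n ⟩
  occurrences a L + equalPairs L + (occurrences a L + equalPairs L) + suc n ∎
  where
  open ≡-Reasoning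
  rearrange : ∀ x p n → suc (x + (x + (p + p + n))) ≡ x + p + (x + p) + suc n
  rearrange = solve-∀

matchingPairs-bound : ∀ {m N} (L : Vec (Fin k) n) → (∀ a → 10 * occurrences a L < N) →
  (W : Vec (Fin k) m) → 10 * matchingPairs W L + m ≤ m * N
matchingPairs-bound L small []                    = z≤n
matchingPairs-bound {m = suc m} {N} L small (w ∷ W) =
  subst (_≤ N + m * N) (rearrange (occurrences w L) (matchingPairs W L) m)
    (+-mono-≤ (small w) (matchingPairs-bound L small W))
  where
  rearrange : ∀ o s m → suc (10 * o) + (10 * s + m) ≡ 10 * (o + s) + suc m
  rearrange = solve-∀

Balanced : Vec (Fin k) n → Set
Balanced {n = n} L = ∀ a → 10 * occurrences a L < 9 * n

balanced? : (L : Vec (Fin k) n) → Dec (Balanced L)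
balanced? {n = n} L = all? λ a → 10 * occurrences a L <? 9 * n

squareSum⇒pairBound : ∀ n p → 10 * (p + p + n) + n ≤ n * (9 * n) →
  20 * p + n * n ≤ 10 * n * (n ∸ 1)
squareSum⇒pairBound zero    p h = subst (_≤ 0) (double p) h
  where
  double : ∀ p → 10 * (p + p + 0) + 0 ≡ 20 * p + 0
  double = solve-∀
squareSum⇒pairBound (suc n) p h = m+n≤o⇒m≤o (20 * p + suc n * suc n)
  (+-cancelʳ-≤ (10 * suc n) _ _ (subst₂ _≤_ (left p n) (right n) (+-monoˡ-≤ (suc n * suc n) h)))
  where
  left : ∀ p n →
    10 * (p + p + suc n) + suc n + suc n * suc n ≡ 20 * p + suc n * suc n + suc n + 10 * suc n
  left = solve-∀
  right : ∀ n → suc n * (9 * suc n) + suc n * suc n ≡ 10 * suc n * n + 10 * suc n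
  right = solve-∀

balanced⇒pairBound : (L : Vec (Fin k) n) → Balanced L →
  20 * equalPairs L + n * n ≤ 10 * n * (n ∸ 1)
balanced⇒pairBound {n = n} L balanced = squareSum⇒pairBound n (equalPairs L)
  (subst (λ s → 10 * s + n ≤ n * (9 * n)) (matchingPairs-self L)
    (matchingPairs-bound L balanced L))

labelClass : Fin k → Vec (Fin k) n → Subset n
labelClass a []      = []
labelClass a (b ∷ L) with b ≟ a
... | yes _ = inside  ∷ labelClass a L
... | no  _ = outside ∷ labelClass a L

∣labelClass∣ : (a : Fin k) (L : Vec (Fin k) n) → ∣ labelClass a L ∣ ≡ occurrences a L
∣labelClass∣ a []      = refl
∣labelClass∣ a (b ∷ L) with b ≟ a
... | yes _ = cong suc (∣labelClass∣ a L)
... | no  _ = ∣labelClass∣ a L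

∈-labelClass : (a : Fin k) (L : Vec (Fin k) n) {u : Fin n} →
  u Subset.∈ labelClass a L → lookup L u ≡ a
∈-labelClass a (b ∷ L) {zero}  u∈ with b ≟ a | u∈
... | yes b≡a | _ = b≡a
... | no  _   | ()
∈-labelClass a (b ∷ L) {suc u} u∈ with b ≟ a | u∈
... | yes _ | there u∈′ = ∈-labelClass a L u∈′
... | no  _ | there u∈′ = ∈-labelClass a L u∈′

labelClass-twoColored : (c : Coloring n k) (d a : Fin k) (L : Vec (Fin k) n) →
  Compatible c d L → TwoColoredOn c (labelClass a L)
labelClass-twoColored c d a L compatible = d , a , λ u v p u∈ _ →
  map₂ (λ (≡Lu , _) → trans ≡Lu (∈-labelClass a L u∈)) (compatible u v p)

noLargeTwoColored⇒balanced : (c : Coloring n k) (d : Fin k) (L : Vec (Fin k) n) →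
  Compatible c d L →
  ¬ (Σ (Subset n) λ S → (9 * n ≤ 10 * ∣ S ∣) × TwoColoredOn c S) → Balanced L
noLargeTwoColored⇒balanced {n} c d L compatible noLarge a with 10 * occurrences a L <? 9 * n
... | yes small = small
... | no  large = ⊥-elim (noLarge (labelClass a L , large′ , labelClass-twoColored c d a L compatible))
  where
  large′ : 9 * n ≤ 10 * ∣ labelClass a L ∣
  large′ = subst (λ s → 9 * n ≤ 10 * s) (sym (∣labelClass∣ a L)) (≮⇒≥ large)

-- Enumerating the colourings compatible with a labelling

edgeOptions : Fin k → Fin k → Fin k → List (Fin k)
edgeOptions d a b with b ≟ a
... | yes _ = d ∷ a ∷ []
... | no  _ = d ∷ []

rowOptions : Fin k → Fin k → Vec (Fin k) n → List (Vec (Fin k) n)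
rowOptions d a []      = [] ∷ []
rowOptions d a (b ∷ L) = cartesianProductWith _∷_ (edgeOptions d a b) (rowOptions d a L)

compatibleColorings : Fin k → Vec (Fin k) n → List (Coloring n k)
compatibleColorings d []      = tt ∷ []
compatibleColorings d (a ∷ L) =
  cartesianProductWith _,_ (rowOptions d a L) (compatibleColorings d L)

length-rowOptions : (d a : Fin k) (L : Vec (Fin k) n) →
  length (rowOptions d a L) ≡ 2 ^ occurrences a L
length-rowOptions d a []      = refl
length-rowOptions d a (b ∷ L) with b ≟ a
... | yes _ = trans (length-cartesianProductWith _∷_ (d ∷ a ∷ []) (rowOptions d a L))
                    (cong (2 *_) (length-rowOptions d a L))
... | no  _ = trans (length-cartesianProductWith _∷_ (d ∷ []) (rowOptions d a L))
                    (trans (+-identityʳ _) (length-rowOptions d a L))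

length-compatibleColorings : (d : Fin k) (L : Vec (Fin k) n) →
  length (compatibleColorings d L) ≡ 2 ^ equalPairs L
length-compatibleColorings d []      = refl
length-compatibleColorings d (a ∷ L) =
  trans (length-cartesianProductWith _,_ (rowOptions d a L) (compatibleColorings d L))
    (trans (cong₂ _*_ (length-rowOptions d a L) (length-compatibleColorings d L))
      (sym (^-distribˡ-+-* 2 (occurrences a L) (equalPairs L))))

∈-edgeOptions : (d a b x : Fin k) → x ≡ d ⊎ (x ≡ a × x ≡ b) → x ∈ edgeOptions d a b
∈-edgeOptions d a b x allowed with b ≟ a | allowed
... | yes _   | inj₁ x≡d        = here x≡d
... | yes _   | inj₂ (x≡a , _)  = there (here x≡a)
... | no  _   | inj₁ x≡d        = here x≡d
... | no  b≢a | inj₂ (x≡a , x≡b) = ⊥-elim (b≢a (trans (sym x≡b) x≡a))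

∈-rowOptions : (d a : Fin k) (L r : Vec (Fin k) n) →
  (∀ j → lookup r j ≡ d ⊎ (lookup r j ≡ a × lookup r j ≡ lookup L j)) → r ∈ rowOptions d a L
∈-rowOptions d a []      []      allowed = here refl
∈-rowOptions d a (b ∷ L) (x ∷ r) allowed =
  ∈-cartesianProductWith⁺ _∷_ (∈-edgeOptions d a b x (allowed zero))
    (∈-rowOptions d a L r (allowed ∘ suc))

∈-compatibleColorings : (d : Fin k) (L : Vec (Fin k) n) (c : Coloring n k) →
  Compatible c d L → c ∈ compatibleColorings d L
∈-compatibleColorings d []      tt      compatible = here refl
∈-compatibleColorings d (a ∷ L) (r , c) compatible =
  ∈-cartesianProductWith⁺ _,_ (∈-rowOptions d a L r λ j → compatible zero (suc j) λ ())
    (∈-compatibleColorings d L c compatibleTail)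
  where
  compatibleTail : Compatible c d L
  compatibleTail u v p
    rewrite edgeColor-irrelevant c u v p (λ u≡v → p (suc-injective (cong suc u≡v))) =
    compatible (suc u) (suc v) (p ∘ suc-injective)

-- Enumerating F'(n,k)

maxEqualPairs : ℕ → ℕ
maxEqualPairs n = (10 * n * (n ∸ 1) ∸ n * n) / 20

≤maxEqualPairs : ∀ n p → 20 * p + n * n ≤ 10 * n * (n ∸ 1) → p ≤ maxEqualPairs n
≤maxEqualPairs n p le = subst (_≤ maxEqualPairs n) (m*n/n≡m p 20) (/-monoˡ-≤ 20
  (subst (_≤ 10 * n * (n ∸ 1) ∸ n * n) (*-comm 20 p) (m+n≤o⇒m≤o∸n (20 * p) le)))

maxEqualPairs-bound : 2 ≤ n → 20 * maxEqualPairs n + n * n ≤ 10 * n * (n ∸ 1)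
maxEqualPairs-bound {suc zero}    (s≤s ())
maxEqualPairs-bound {suc (suc j)} _ =
  m≤o∸n⇒m+n≤o (20 * maxEqualPairs (2 + j)) square≤
    (subst (_≤ excess) (*-comm (excess / 20) 20) (m/n*n≤m excess 20))
  where
  excess : ℕ
  excess = 10 * (2 + j) * (1 + j) ∸ (2 + j) * (2 + j)
  square≤ : (2 + j) * (2 + j) ≤ 10 * (2 + j) * (1 + j)
  square≤ = subst ((2 + j) * (2 + j) ≤_) (gap j) (m≤m+n _ _)
    where
    gap : ∀ j → (2 + j) * (2 + j) + (9 * j * j + 26 * j + 16) ≡ 10 * (2 + j) * (1 + j)
    gap = solve-∀

balancedColorings : Fin k → Vec (Fin k) n → List (Coloring n k)
balancedColorings d L with balanced? L
... | yes _ = compatibleColorings d L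
... | no  _ = []

length-balancedColorings : (d : Fin k) (L : Vec (Fin k) n) →
  length (balancedColorings d L) ≤ 2 ^ maxEqualPairs n
length-balancedColorings {n = n} d L with balanced? L
... | no  _        = z≤n
... | yes balanced = subst (_≤ 2 ^ maxEqualPairs n) (sym (length-compatibleColorings d L))
  (^-monoʳ-≤ 2 (≤maxEqualPairs n (equalPairs L) (balanced⇒pairBound L balanced)))

F'-candidates : ∀ k n → List (Coloring n k)
F'-candidates k n = concatMap (λ { (d ∷ L) → balancedColorings d L }) (allVecs k (suc n))

length-F'-candidates : length (F'-candidates k n) ≤ k ^ suc n * 2 ^ maxEqualPairs n
length-F'-candidates {k = k} {n = n} = subst (λ l → length (F'-candidates k n) ≤ l * 2 ^ maxEqualPairs n)
  (length-allVecs k (suc n))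
  (length-concatMap-≤ _ (λ { (d ∷ L) → length-balancedColorings d L }) (allVecs k (suc n)))

∈-F'-candidates : (c : Coloring n k) → InF' c → c ∈ F'-candidates k n
∈-F'-candidates c (inF , noLarge) with InF⇒compatible c inF
... | d , L , compatible = ∈-concatMap⁺ _ (lose (∈-allVecs (d ∷ L)) c∈)
  where
  c∈ : c ∈ balancedColorings d L
  c∈ with balanced? L
  ... | yes _          = ∈-compatibleColorings d L c compatible
  ... | no  unbalanced = ⊥-elim (unbalanced (noLargeTwoColored⇒balanced c d L compatible noLarge))

^-distribʳ-* : ∀ x y e → (x * y) ^ e ≡ x ^ e * y ^ e
^-distribʳ-* x y zero    = refl
^-distribʳ-* x y (suc e) =
  trans (cong (x * y *_) (^-distribʳ-* x y e)) ([m*n]*[o*p]≡[m*o]*[n*p] x y (x ^ e) (y ^ e))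

twentiethPower-bound : ∀ {m K P s T} → m ≤ K * 2 ^ P → 20 * P + s ≤ T →
  m ^ 20 * 2 ^ s ≤ 2 ^ T * K ^ 20
twentiethPower-bound {m} {K} {P} {s} {T} m≤ exponent≤ = begin
  m ^ 20 * 2 ^ s              ≤⟨ *-monoˡ-≤ (2 ^ s) (^-monoˡ-≤ 20 m≤) ⟩
  (K * 2 ^ P) ^ 20 * 2 ^ s    ≡⟨ cong (_* 2 ^ s) (^-distribʳ-* K (2 ^ P) 20) ⟩
  K ^ 20 * (2 ^ P) ^ 20 * 2 ^ s ≡⟨ *-assoc (K ^ 20) _ _ ⟩
  K ^ 20 * ((2 ^ P) ^ 20 * 2 ^ s)
    ≡⟨ cong (λ x → K ^ 20 * (x * 2 ^ s)) (trans (^-*-assoc 2 P 20) (cong (2 ^_) (*-comm P 20))) ⟩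
  K ^ 20 * (2 ^ (20 * P) * 2 ^ s) ≡⟨ cong (K ^ 20 *_) (sym (^-distribˡ-+-* 2 (20 * P) s)) ⟩
  K ^ 20 * 2 ^ (20 * P + s)   ≤⟨ *-monoʳ-≤ (K ^ 20) (^-monoʳ-≤ 2 exponent≤) ⟩
  K ^ 20 * 2 ^ T              ≡⟨ *-comm (K ^ 20) (2 ^ T) ⟩
  2 ^ T * K ^ 20              ∎
  where open ≤-Reasoning

lemma2p6 : (n k : ℕ) → 2 ≤ n → 2 ≤ k →
    (m : ℕ) (f : Fin m → Coloring n k) → Injective _≡_ _≡_ f →
    (∀ i → InF' (f i)) →
    m ^ 20 * 2 ^ (n * n) ≤ 2 ^ (10 * n * (n ∸ 1)) * k ^ (20 * (n + 1))
lemma2p6 n k 2≤n _ m f f-inj inF' =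
  subst (λ e → m ^ 20 * 2 ^ (n * n) ≤ 2 ^ (10 * n * (n ∸ 1)) * e) k^[n+1]^20
    (twentiethPower-bound {K = k ^ suc n} {P = maxEqualPairs n} m≤ (maxEqualPairs-bound 2≤n))
  where
  m≤ : m ≤ k ^ suc n * 2 ^ maxEqualPairs n
  m≤ = ≤-trans (injective⇒≤length f f-inj (F'-candidates k n) (λ i → ∈-F'-candidates (f i) (inF' i)))
               (length-F'-candidates {k = k})
  k^[n+1]^20 : (k ^ suc n) ^ 20 ≡ k ^ (20 * (n + 1))
  k^[n+1]^20 = trans (^-*-assoc k (suc n) 20)
    (cong (k ^_) (trans (*-comm (suc n) 20) (cong (20 *_) (+-comm 1 n))))
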